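{- Let $\mathsf{CS}$ be an axiomatically appropriate and schematic constant specification for $\mathsf{JE}$. There exists a realization $r$ such that for every modal formula $A$: if $\mathsf{GE}\vdash\ \supset A$, then $\mathsf{JE}_{\mathsf{CS}}\vdash r(A)$.
   Context: Justification language. Fix countably many proof constants $\alpha_i$, proof variables $\xi_i$, and a countable set $\mathsf{Prop}$ of atomic propositions. Proof terms: $\lambda ::= \alpha_i \mid \xi_i \mid (\lambda\cdot\lambda) \mid (\lambda+\lambda) \mid\ !\lambda$. Justification terms: $t ::= \mathsf{e}(\lambda)$, $\lambda$ a proof term. Formulas: $F ::= P\mid\bot\mid(F\to F)\mid\lambda:F\mid[t]F$; other connectives are classical abbreviations. Axioms of $\mathsf{JE}$: all instances of classical propositional tautologies and of (j) $\lambda:(F\to G)\to(\kappa:F\to\lambda\cdot\kappa:G)$; (j+$_1$) $(\lambda:F\vee\kappa:F)\to(\lambda+\kappa):F$; (jt) $\lambda:F\to F$; (j4) $\lambda:F\to\ !\lambda:\lambda:F$; (je) $(\lambda:(F\to G)\wedge\lambda:(G\to F))\to([\mathsf{e}(\lambda)]F\to[\mathsf{e}(\lambda)]G)$; (je+) $([\mathsf{e}(\lambda)]F\vee[\mathsf{e}(\kappa)]F)\to[\mathsf{e}(\lambda+\kappa)]F$. A constant specification $\mathsf{CS}$ is a set of pairs $(\alpha,A)$, $\alpha$ a proof constant, $A$ an axiom of $\mathsf{JE}$; it is axiomatically appropriate if every axiom has some constant $\alpha$ with $(\alpha,A)\in\mathsf{CS}$, and schematic if for each constant $c$ the set $\{A\mid(c,A)\in\mathsf{CS}\}$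 consists of all instances of one or several (possibly zero) axiom schemes of $\mathsf{JE}$. $\mathsf{JE}_{\mathsf{CS}}$ is the Hilbert system with the axioms of $\mathsf{JE}$, modus ponens, and axiom necessitation (infer $\alpha:A$ whenever $(\alpha,A)\in\mathsf{CS}$). Modal language: $A ::= P\mid\bot\mid(A\to A)\mid\Box A$. The sequent calculus $\mathsf{GE}$ works with sequents $\Gamma\supset\Delta$ ($\Gamma,\Delta$ finite multisets of modal formulas) and has: axioms $P\supset P$ and $\bot\supset$; rules $(\to\supset)$: from $\Gamma\supset\Delta,A$ and $B,\Gamma\supset\Delta$ infer $A\to B,\Gamma\supset\Delta$; $(\supset\to)$: from $A,\Gamma\supset\Delta,B$ infer $\Gamma\supset\Delta,A\to B$; weakening on both sides (from $\Gamma\supset\Delta$ infer $A,\Gamma\supset\Delta$ and $\Gamma\supset\Delta,A$); contraction on both sides (from $A,A,\Gamma\supset\Delta$ infer $A,\Gamma\supset\Delta$; from $\Gamma\supset\Delta,A,A$ infer $\Gamma\supset\Delta,A$); and (RE): from $A\supset B$ and $B\supset A$ infer $\Box A\supset\Box B$. Realization. Let $\mathsf{Fm}^{\mathsf J}$ be the set of justification formulas with no subformula of the form $\lambda:F$. The forgetful translation $^\circ:\mathsf{Fm}^{\mathsf J}\to$ modal formulas is $\bot^\circ=\bot$, $P^\circ=P$, $(A\to B)^\circ=A^\circ\to B^\circ$, $([t]A)^\circ=\Box A^\circ$. A realization is a map $r$ from modal formulas to $\mathsf{Fm}^{\mathsf J}$ with $(r(A))^\circ=A$ for all modal $A$. 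-}

module Defs where

open import Data.Nat using (ℕ)
open import Data.Bool using (Bool; true; false; not; _∨_)
open import Data.List using (List; []; _∷_)
open import Data.List.Relation.Binary.Permutation.Propositional using (_↭_)
open import Data.Product using (Σ; _×_; _,_; ∃)
open import Relation.Binary.PropositionalEquality using (_≡_)
open import Data.Empty using (⊥)
open import Data.Unit using (⊤)

infixl 7 _·_
infixl 6 _⊕_
infixr 5 _⇒_
infix 4 _∶_
infix 8 !_

data PTerm : Set where
  pc  : ℕ → PTerm
  pv  : ℕ → PTerm
  _·_ : PTerm → PTerm → PTerm
  _⊕_ : PTerm → PTerm → PTerm
  !_  : PTerm → PTerm

data JTerm : Set where
  e : PTerm → JTerm

data Fm : Set where
  atom : ℕ → Fm
  bot  : Fm
  _⇒_  : Fm → Fm → Fm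
  _∶_  : PTerm → Fm → Fm
  [_]_ : JTerm → Fm → Fm

~_ : Fm → Fm
~ A = A ⇒ bot

_∨ᶠ_ : Fm → Fm → Fm
A ∨ᶠ B = (~ A) ⇒ B

_∧ᶠ_ : Fm → Fm → Fm
A ∧ᶠ B = ~ (A ⇒ ~ B)

data PFm : Set where
  pvar : ℕ → PFm
  pbot : PFm
  _⇛_  : PFm → PFm → PFm

evalP : (ℕ → Bool) → PFm → Bool
evalP v (pvar n) = v n
evalP v pbot = false
evalP v (φ ⇛ ψ) = not (evalP v φ) ∨ evalP v ψ

Tautology : PFm → Set
Tautology φ = ∀ (v : ℕ → Bool) → evalP v φ ≡ true

substP : (ℕ → Fm) → PFm → Fm
substP σ (pvar n) = σ n
substP σ pbot = bot
substP σ (φ ⇛ ψ) = substP σ φ ⇒ substP σ ψ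

data Scheme : Set where
  taut  : (φ : PFm) → Tautology φ → Scheme   -- one scheme per tautology
  sj sj+₁ sjt sj4 sje sje+ : Scheme

data Inst : Scheme → Fm → Set where
  i-taut : ∀ φ (τ : Tautology φ) (σ : ℕ → Fm) → Inst (taut φ τ) (substP σ φ)
  i-j    : ∀ l k F G → Inst sj ((l ∶ (F ⇒ G)) ⇒ ((k ∶ F) ⇒ ((l · k) ∶ G)))
  i-j+₁  : ∀ l k F → Inst sj+₁ (((l ∶ F) ∨ᶠ (k ∶ F)) ⇒ ((l ⊕ k) ∶ F))
  i-jt   : ∀ l F → Inst sjt ((l ∶ F) ⇒ F)
  i-j4   : ∀ l F → Inst sj4 ((l ∶ F) ⇒ ((! l) ∶ (l ∶ F)))
  i-je   : ∀ l F G → Inst sje (((l ∶ (F ⇒ G)) ∧ᶠ (l ∶ (G ⇒ F)))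
                               ⇒ (([ e l ] F) ⇒ ([ e l ] G)))
  i-je+  : ∀ l k F → Inst sje+ ((([ e l ] F) ∨ᶠ ([ e k ] F)) ⇒ ([ e (l ⊕ k) ] F))

Axiom : Fm → Set
Axiom A = Σ Scheme (λ s → Inst s A)

-- Constant specifications: CS c A means (α_c , A) ∈ CS

ConstSpec : Set₁
ConstSpec = ℕ → Fm → Set

IsConstSpec : ConstSpec → Set
IsConstSpec CS = ∀ c A → CS c A → Axiom A

AxiomaticallyAppropriate : ConstSpec → Set
AxiomaticallyAppropriate CS = ∀ A → Axiom A → ∃ (λ c → CS c A)

-- for each constant c, {A | (c,A) ∈ CS} is exactly the set of all
-- instances of the schemes in some (possibly empty) set S of schemes
Schematic : ConstSpec → Set₁
Schematic CS = ∀ c → Σ (Scheme → Set) (λ S →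
  ∀ A → (CS c A → Σ Scheme (λ s → S s × Inst s A))
      × (Σ Scheme (λ s → S s × Inst s A) → CS c A))

data JE⊢ (CS : ConstSpec) : Fm → Set where
  ax  : ∀ {A} → Axiom A → JE⊢ CS A
  mp  : ∀ {A B} → JE⊢ CS (A ⇒ B) → JE⊢ CS A → JE⊢ CS B
  an  : ∀ {c A} → CS c A → JE⊢ CS (pc c ∶ A)

data MFm : Set where
  matom : ℕ → MFm
  mbot  : MFm
  _⊃ₘ_  : MFm → MFm → MFm
  □_    : MFm → MFm

-- Sequents Γ ⊃ Δ with multisets represented as lists up to permutation
data GE : List MFm → List MFm → Set where
  ax-P   : ∀ P → GE (matom P ∷ []) (matom P ∷ [])
  ax-⊥   : GE (mbot ∷ []) []
  perm   : ∀ {Γ Γ' Δ Δ'} → Γ ↭ Γ' → Δ ↭ Δ' → GE Γ Δ → GE Γ' Δ'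
  ⊃L     : ∀ {Γ Δ A B} → GE Γ (A ∷ Δ) → GE (B ∷ Γ) Δ → GE ((A ⊃ₘ B) ∷ Γ) Δ
  ⊃R     : ∀ {Γ Δ A B} → GE (A ∷ Γ) (B ∷ Δ) → GE Γ ((A ⊃ₘ B) ∷ Δ)
  wL     : ∀ {Γ Δ A} → GE Γ Δ → GE (A ∷ Γ) Δ
  wR     : ∀ {Γ Δ A} → GE Γ Δ → GE Γ (A ∷ Δ)
  cL     : ∀ {Γ Δ A} → GE (A ∷ A ∷ Γ) Δ → GE (A ∷ Γ) Δ
  cR     : ∀ {Γ Δ A} → GE Γ (A ∷ A ∷ Δ) → GE Γ (A ∷ Δ)
  RE     : ∀ {A B} → GE (A ∷ []) (B ∷ []) → GE (B ∷ []) (A ∷ [])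
           → GE ((□ A) ∷ []) ((□ B) ∷ [])

InFmJ : Fm → Set
InFmJ (atom _) = ⊤
InFmJ bot = ⊤
InFmJ (A ⇒ B) = InFmJ A × InFmJ B
InFmJ (_ ∶ _) = ⊥
InFmJ ([ _ ] A) = InFmJ A

forget : (F : Fm) → InFmJ F → MFm
forget (atom P) _ = matom P
forget bot _ = mbot
forget (A ⇒ B) (a , b) = forget A a ⊃ₘ forget B b
forget (_ ∶ _) ()
forget ([ _ ] A) a = □ forget A a

record Realization : Set where
  field
    r      : MFm → Fm
    r-FmJ  : ∀ A → InFmJ (r A)
    r-forg : ∀ A → forget (r A) (r-FmJ A) ≡ A

-- Fix C and realize every box of C as [e(Ω)] for a single proof term Ω. Reading atoms and
-- boxed subformulas of C as propositional variables, a GE-proof of C shows that C follows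
-- propositionally from finitely many lemmas □P → □Q obtained by (RE), where P → Q and Q → P
-- in turn follow propositionally from lemmas of lower level. Tautologies being decidable,
-- this stratified set of lemmas is computed from C alone, without the derivation. By
-- induction on the level every lemma gets a justification: P → Q by a tautology constant
-- applied to the terms of the lower lemmas, and [e(Ω)]P → [e(Ω)]Q by (je) once Ω justifies
-- P → Q and Q → P, which holds because Ω is the (j+) sum of all those terms. The circularity
-- is harmless because CS is schematic: the constants can be fixed before Ω is known, as a
-- constant justifying one instance of a scheme justifies all of them.
module Submission where

open import Defs
open import Data.Bool using (Bool; true; false; not; _∨_)
open import Data.Bool.Properties using () renaming (_≟_ to _≟ᵇ_)
open import Data.Empty using (⊥; ⊥-elim)
open import Data.List using (List; []; _∷_; _++_; map; foldr; foldl; concat; applyUpTo; filter; cartesianProduct)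
open import Data.List.Membership.Propositional using (_∈_)
open import Data.List.Membership.Propositional.Properties
  using (∈-++⁺ˡ; ∈-++⁺ʳ; ∈-++⁻; ∈-map⁺; ∈-concat⁺′; ∈-applyUpTo⁺; ∈-filter⁺; ∈-filter⁻;
         ∈-cartesianProduct⁺; ∈-cartesianProduct⁻)
open import Data.List.Relation.Binary.Permutation.Propositional using (↭-sym)
open import Data.List.Relation.Binary.Permutation.Propositional.Properties using (All-resp-↭; Any-resp-↭)
open import Data.List.Relation.Binary.Subset.Propositional using (_⊆_)
open import Data.List.Relation.Unary.All as All using (All; []; _∷_)
open import Data.List.Relation.Unary.Any using (Any; here; there; toSum; fromSum)
open import Data.List.Relation.Unary.Any.Properties using (singleton⁻)
open import Data.Nat using (ℕ; zero; suc; _+_; _⊔_; _≤_; _<_; z≤n; s≤s; _<?_) renaming (_≟_ to _≟ℕ_)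
open import Data.Nat.Properties
  using (≤-refl; ≤-trans; <⇒≤; >⇒≢; ≤∧≢⇒<; <-≤-trans; <⇒≱; m≤m⊔n; m≤n⊔m; m≤m+n; m≤n+m; n<1+n)
open import Data.Product using (Σ; ∃₂; _×_; _,_; proj₁; proj₂)
open import Data.Product.Properties using (≡-dec)
open import Data.Sum using (_⊎_; inj₁; inj₂; [_,_]′)
open import Data.Unit using (⊤; tt)
open import Function using (_∘_; id)
open import Relation.Binary.Definitions using (DecidableEquality)
open import Relation.Binary.PropositionalEquality using (_≡_; _≢_; refl; sym; trans; cong; cong₂; subst)
open import Relation.Nullary using (Dec; yes; no; ¬_)
open import Relation.Nullary.Decidable using (map′; _×-dec_)

-- Propositional tautologies are decidable

infix 4 _⊨_

_⊨_ : (ℕ → Bool) → PFm → Set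
v ⊨ φ = evalP v φ ≡ true

⊨-mp : ∀ {v φ ψ} → v ⊨ (φ ⇛ ψ) → v ⊨ φ → v ⊨ ψ
⊨-mp {v} {φ} φ⇛ψ φ-true with evalP v φ
⊨-mp φ⇛ψ refl | true = φ⇛ψ
⊨-mp φ⇛ψ ()   | false

⊨-⇛-intro : ∀ {v φ ψ} → (v ⊨ φ → v ⊨ ψ) → v ⊨ (φ ⇛ ψ)
⊨-⇛-intro {v} {φ} f with evalP v φ
... | true = f refl
... | false = refl

⊨-⇛-or : ∀ {v φ ψ} {B : Set} → (v ⊨ φ → v ⊨ ψ ⊎ B) → v ⊨ (φ ⇛ ψ) ⊎ B
⊨-⇛-or {v} {φ} f with evalP v φ
... | true = f refl
... | false = inj₁ refl

varBound : PFm → ℕ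
varBound (pvar n) = suc n
varBound pbot = 0
varBound (φ ⇛ ψ) = varBound φ ⊔ varBound ψ

evalP-cong : ∀ {v w} φ → (∀ n → n < varBound φ → v n ≡ w n) → evalP v φ ≡ evalP w φ
evalP-cong (pvar n) v≈w = v≈w n ≤-refl
evalP-cong pbot v≈w = refl
evalP-cong (φ ⇛ ψ) v≈w = cong₂ (λ a b → not a ∨ b)
  (evalP-cong φ (λ n n< → v≈w n (<-≤-trans n< (m≤m⊔n (varBound φ) (varBound ψ)))))
  (evalP-cong ψ (λ n n< → v≈w n (<-≤-trans n< (m≤n⊔m (varBound φ) (varBound ψ)))))

update : (ℕ → Bool) → ℕ → Bool → ℕ → Bool
update v k b n with n ≟ℕ k
... | yes _ = b
... | no _ = v n

update-≢ : ∀ {v k b n} → n ≢ k → update v k b n ≡ v n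
update-≢ {k = k} {n = n} n≢k with n ≟ℕ k
... | yes n≡k = ⊥-elim (n≢k n≡k)
... | no _ = refl

AgreeFrom : ℕ → (ℕ → Bool) → (ℕ → Bool) → Set
AgreeFrom k w v = ∀ n → k ≤ n → w n ≡ v n

agreeFrom-update : ∀ {k w v b} → AgreeFrom k w (update v k b) → AgreeFrom (suc k) w v
agreeFrom-update w≈v n k<n = trans (w≈v n (<⇒≤ k<n)) (update-≢ (>⇒≢ k<n))

agreeFrom-set : ∀ {k w v b} → w k ≡ b → AgreeFrom (suc k) w v → AgreeFrom k w (update v k b)
agreeFrom-set {k} wk≡b w≈v n k≤n with n ≟ℕ k
... | yes refl = wk≡b
... | no n≢k = w≈v n (≤∧≢⇒< k≤n (n≢k ∘ sym))

ValidAbove : PFm → ℕ → (ℕ → Bool) → Set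
ValidAbove φ k v = ∀ w → AgreeFrom k w v → w ⊨ φ

validAbove? : ∀ φ k v → Dec (ValidAbove φ k v)
validAbove? φ zero v =
  map′ (λ v⊨φ w w≈v → trans (evalP-cong φ (λ n _ → w≈v n z≤n)) v⊨φ)
       (λ valid → valid v (λ _ _ → refl))
       (evalP v φ ≟ᵇ true)
validAbove? φ (suc k) v =
  map′ merge split (validAbove? φ k (update v k true) ×-dec validAbove? φ k (update v k false))
  where
  split : ValidAbove φ (suc k) v → ValidAbove φ k (update v k true) × ValidAbove φ k (update v k false)
  split valid = (λ w → valid w ∘ agreeFrom-update) , (λ w → valid w ∘ agreeFrom-update)

  merge : ValidAbove φ k (update v k true) × ValidAbove φ k (update v k false) → ValidAbove φ (suc k) v
  merge (valid-true , valid-false) w w≈v with w k in wk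
  ... | true = valid-true w (agreeFrom-set wk w≈v)
  ... | false = valid-false w (agreeFrom-set wk w≈v)

truncate : ℕ → (ℕ → Bool) → ℕ → Bool
truncate N w n with n <? N
... | yes _ = w n
... | no _ = false

truncate-below : ∀ {N w n} → n < N → truncate N w n ≡ w n
truncate-below {N} {n = n} n<N with n <? N
... | yes _ = refl
... | no n≮N = ⊥-elim (n≮N n<N)

truncate-above : ∀ {N w} → AgreeFrom N (truncate N w) (λ _ → false)
truncate-above {N} n N≤n with n <? N
... | yes n<N = ⊥-elim (<⇒≱ n<N N≤n)
... | no _ = refl

taut? : (φ : PFm) → Dec (Tautology φ)
taut? φ = map′ valid⇒taut (λ τ w _ → τ w) (validAbove? φ (varBound φ) (λ _ → false))
  where
  valid⇒taut : ValidAbove φ (varBound φ) (λ _ → false) → Tautology φ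
  valid⇒taut valid w = trans (evalP-cong φ (λ _ n< → sym (truncate-below n<)))
                             (valid (truncate (varBound φ) w) truncate-above)

-- Schematic constant specifications

evalF : (Fm → Bool) → Fm → Bool
evalF w bot = false
evalF w (A ⇒ B) = not (evalF w A) ∨ evalF w B
evalF w A = w A

evalF-substP : ∀ w σ φ → evalF w (substP σ φ) ≡ evalP (evalF w ∘ σ) φ
evalF-substP w σ (pvar n) = refl
evalF-substP w σ pbot = refl
evalF-substP w σ (φ ⇛ ψ) = cong₂ (λ a b → not a ∨ b) (evalF-substP w σ φ) (evalF-substP w σ ψ)

tautology-instance-refuted : ∀ {φ τ X} w → evalF w X ≡ false → ¬ Inst (taut φ τ) X
tautology-instance-refuted w wX≡false (i-taut φ τ σ)
  with () ← trans (sym wX≡false) (trans (evalF-substP w σ φ) (τ _))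

Propositional : Fm → Set
Propositional (atom _) = ⊤
Propositional bot = ⊤
Propositional (A ⇒ B) = Propositional A × Propositional B
Propositional _ = ⊥

substP-atom-propositional : ∀ φ → Propositional (substP atom φ)
substP-atom-propositional (pvar n) = tt
substP-atom-propositional pbot = tt
substP-atom-propositional (φ ⇛ ψ) = substP-atom-propositional φ , substP-atom-propositional ψ

unatom : Fm → PFm
unatom (atom n) = pvar n
unatom (A ⇒ B) = unatom A ⇛ unatom B
unatom _ = pbot

unatom-substP : ∀ φ → unatom (substP atom φ) ≡ φ
unatom-substP (pvar n) = refl
unatom-substP pbot = refl
unatom-substP (φ ⇛ ψ) = cong₂ _⇛_ (unatom-substP φ) (unatom-substP ψ)

⇒-injective : ∀ {A B A′ B′} → A ⇒ B ≡ A′ ⇒ B′ → A ≡ A′ × B ≡ B′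
⇒-injective refl = refl , refl

substP-factor : ∀ σ σ′ φ′ φ → substP σ′ φ′ ≡ substP atom φ
              → substP σ φ ≡ substP (substP σ ∘ unatom ∘ σ′) φ′
substP-factor σ σ′ (pvar n) φ eq = cong (substP σ) (sym (trans (cong unatom eq) (unatom-substP φ)))
substP-factor σ σ′ pbot pbot eq = refl
substP-factor σ σ′ (φ′ ⇛ ψ′) (φ ⇛ ψ) eq =
  cong₂ _⇒_ (substP-factor σ σ′ φ′ φ (proj₁ (⇒-injective eq)))
            (substP-factor σ σ′ ψ′ ψ (proj₂ (⇒-injective eq)))
substP-factor σ σ′ pbot (pvar _) ()
substP-factor σ σ′ pbot (_ ⇛ _) ()
substP-factor σ σ′ (_ ⇛ _) (pvar _) ()
substP-factor σ σ′ (_ ⇛ _) pbot ()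

propositional-instance⇒taut : ∀ {s X} → Inst s X → Propositional X → ∃₂ λ φ τ → s ≡ taut φ τ
propositional-instance⇒taut (i-taut φ τ _) _ = φ , τ , refl
propositional-instance⇒taut (i-j _ _ _ _) (() , _)
propositional-instance⇒taut (i-j+₁ _ _ _) (_ , ())
propositional-instance⇒taut (i-jt _ _) (() , _)
propositional-instance⇒taut (i-j4 _ _) (() , _)
propositional-instance⇒taut (i-je _ _ _) (_ , () , _)
propositional-instance⇒taut (i-je+ _ _ _) (_ , ())

substP-atom-instance : ∀ {s X} φ σ → Inst s X → X ≡ substP atom φ → Inst s (substP σ φ)
substP-atom-instance φ σ inst eq
  with _ , _ , refl ← propositional-instance⇒taut inst (subst Propositional (sym eq) (substP-atom-propositional φ))
  with i-taut φ′ τ σ′ ← inst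
  = subst (Inst (taut φ′ τ)) (sym (substP-factor σ σ′ φ′ φ eq)) (i-taut φ′ τ _)

jeAxiom : PTerm → Fm → Fm → Fm
jeAxiom t F G = ((t ∶ (F ⇒ G)) ∧ᶠ (t ∶ (G ⇒ F))) ⇒ (([ e t ] F) ⇒ ([ e t ] G))

sumAxiom : PTerm → PTerm → Fm → Fm
sumAxiom s t F = ((s ∶ F) ∨ᶠ (t ∶ F)) ⇒ ((s ⊕ t) ∶ F)

jeAxiom₀ : Fm
jeAxiom₀ = jeAxiom (pc 0) bot (bot ⇒ bot)

sumAxiom₀ : Fm
sumAxiom₀ = sumAxiom (pc 0) (pc 1) bot

-- Falsifies jeAxiom₀ and sumAxiom₀, so neither is an instance of a tautology.
separating : Fm → Bool
separating ([ _ ] (_ ⇒ _)) = false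
separating ((_ ⊕ _) ∶ _) = false
separating _ = true

je-scheme : ∀ {s X} → Inst s X → X ≡ jeAxiom₀ → s ≡ sje
je-scheme (i-taut φ τ σ) eq = ⊥-elim (tautology-instance-refuted separating refl (subst (Inst _) eq (i-taut φ τ σ)))
je-scheme (i-je _ _ _) _ = refl
je-scheme (i-j _ _ _ _) ()
je-scheme (i-j+₁ _ _ _) ()
je-scheme (i-jt _ _) ()
je-scheme (i-j4 _ _) ()
je-scheme (i-je+ _ _ _) ()

sum-scheme : ∀ {s X} → Inst s X → X ≡ sumAxiom₀ → s ≡ sj+₁
sum-scheme (i-taut φ τ σ) eq = ⊥-elim (tautology-instance-refuted separating refl (subst (Inst _) eq (i-taut φ τ σ)))
sum-scheme (i-j+₁ _ _ _) _ = refl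
sum-scheme (i-j _ _ _ _) ()
sum-scheme (i-jt _ _) ()
sum-scheme (i-j4 _ _) ()
sum-scheme (i-je _ _ _) ()
sum-scheme (i-je+ _ _ _) ()

module SchematicConstants (CS : ConstSpec) (appropriate : AxiomaticallyAppropriate CS) (schematic : Schematic CS) where

  constant : (A : Fm) → Axiom A → ℕ
  constant A a = proj₁ (appropriate A a)

  constant-schematic : ∀ {A B} (a : Axiom A) → (∀ {s} → Inst s A → Inst s B) → CS (constant A a) B
  constant-schematic {A} {B} a transfer with schematic (constant A a)
  ... | S , spec with proj₁ (spec A) (proj₂ (appropriate A a))
  ... | s , s∈S , inst = proj₂ (spec B) (s , s∈S , transfer inst)

  tautConstant : (φ : PFm) → Tautology φ → ℕ
  tautConstant φ τ = constant (substP atom φ) (taut φ τ , i-taut φ τ atom)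

  tautConstant-spec : ∀ φ τ σ → CS (tautConstant φ τ) (substP σ φ)
  tautConstant-spec φ τ σ = constant-schematic _ (λ inst → substP-atom-instance φ σ inst refl)

  jeConstant : ℕ
  jeConstant = constant jeAxiom₀ (sje , i-je _ _ _)

  jeConstant-spec : ∀ t F G → CS jeConstant (jeAxiom t F G)
  jeConstant-spec t F G = constant-schematic _ transfer
    where
    transfer : ∀ {s} → Inst s jeAxiom₀ → Inst s (jeAxiom t F G)
    transfer inst with refl ← je-scheme inst refl = i-je t F G

  sumConstant : ℕ
  sumConstant = constant sumAxiom₀ (sj+₁ , i-j+₁ _ _ _)

  sumConstant-spec : ∀ s t F → CS sumConstant (sumAxiom s t F)
  sumConstant-spec s t F = constant-schematic _ transfer
    where
    transfer : ∀ {s′} → Inst s′ sumAxiom₀ → Inst s′ (sumAxiom s t F)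
    transfer inst with refl ← sum-scheme inst refl = i-j+₁ s t F

matom-injective : ∀ {P Q} → matom P ≡ matom Q → P ≡ Q
matom-injective refl = refl

⊃ₘ-injective : ∀ {A B A′ B′} → A ⊃ₘ B ≡ A′ ⊃ₘ B′ → A ≡ A′ × B ≡ B′
⊃ₘ-injective refl = refl , refl

□-injective : ∀ {A B} → □ A ≡ □ B → A ≡ B
□-injective refl = refl

_≟ₘ_ : DecidableEquality MFm
matom P ≟ₘ matom Q = map′ (cong matom) matom-injective (P ≟ℕ Q)
mbot ≟ₘ mbot = yes refl
(A ⊃ₘ B) ≟ₘ (A′ ⊃ₘ B′) =
  map′ (λ (p , q) → cong₂ _⊃ₘ_ p q) ⊃ₘ-injective ((A ≟ₘ A′) ×-dec (B ≟ₘ B′))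
(□ A) ≟ₘ (□ B) = map′ (cong □_) □-injective (A ≟ₘ B)
matom _ ≟ₘ mbot = no λ ()
matom _ ≟ₘ (_ ⊃ₘ _) = no λ ()
matom _ ≟ₘ (□ _) = no λ ()
mbot ≟ₘ matom _ = no λ ()
mbot ≟ₘ (_ ⊃ₘ _) = no λ ()
mbot ≟ₘ (□ _) = no λ ()
(_ ⊃ₘ _) ≟ₘ matom _ = no λ ()
(_ ⊃ₘ _) ≟ₘ mbot = no λ ()
(_ ⊃ₘ _) ≟ₘ (□ _) = no λ ()
(□ _) ≟ₘ matom _ = no λ ()
(□ _) ≟ₘ mbot = no λ ()
(□ _) ≟ₘ (_ ⊃ₘ _) = no λ ()

size : MFm → ℕ
size (matom _) = 1
size mbot = 1
size (A ⊃ₘ B) = suc (size A + size B)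
size (□ A) = suc (size A)

subformulas : MFm → List MFm
subformulas (A ⊃ₘ B) = (A ⊃ₘ B) ∷ subformulas A ++ subformulas B
subformulas (□ A) = □ A ∷ subformulas A
subformulas A = A ∷ []

subformulas-⊃ˡ : ∀ {A B} → subformulas A ⊆ subformulas (A ⊃ₘ B)
subformulas-⊃ˡ = there ∘ ∈-++⁺ˡ

subformulas-⊃ʳ : ∀ {A B} → subformulas B ⊆ subformulas (A ⊃ₘ B)
subformulas-⊃ʳ {A} = there ∘ ∈-++⁺ʳ (subformulas A)

subformulas-□ : ∀ {A} → subformulas A ⊆ subformulas (□ A)
subformulas-□ = there

subformulas-refl : ∀ A → A ∈ subformulas A
subformulas-refl (matom _) = here refl
subformulas-refl mbot = here refl
subformulas-refl (_ ⊃ₘ _) = here refl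
subformulas-refl (□ _) = here refl

subformulas-trans : ∀ C {A} → A ∈ subformulas C → subformulas A ⊆ subformulas C
subformulas-trans (matom _) (here refl) = id
subformulas-trans mbot (here refl) = id
subformulas-trans (A ⊃ₘ B) (here refl) = id
subformulas-trans (A ⊃ₘ B) (there X∈) with ∈-++⁻ (subformulas A) X∈
... | inj₁ X∈A = subformulas-⊃ˡ ∘ subformulas-trans A X∈A
... | inj₂ X∈B = subformulas-⊃ʳ {A} ∘ subformulas-trans B X∈B
subformulas-trans (□ A) (here refl) = id
subformulas-trans (□ A) (there X∈) = subformulas-□ ∘ subformulas-trans A X∈

boxed : List MFm → List MFm
boxed [] = []
boxed (matom _ ∷ K) = boxed K
boxed (mbot ∷ K) = boxed K
boxed ((_ ⊃ₘ _) ∷ K) = boxed K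
boxed (□ A ∷ K) = A ∷ boxed K

∈-boxed⁺ : ∀ {A} K → □ A ∈ K → A ∈ boxed K
∈-boxed⁺ (□ _ ∷ K) (here refl) = here refl
∈-boxed⁺ (matom _ ∷ K) (there □A∈) = ∈-boxed⁺ K □A∈
∈-boxed⁺ (mbot ∷ K) (there □A∈) = ∈-boxed⁺ K □A∈
∈-boxed⁺ ((_ ⊃ₘ _) ∷ K) (there □A∈) = ∈-boxed⁺ K □A∈
∈-boxed⁺ (□ _ ∷ K) (there □A∈) = there (∈-boxed⁺ K □A∈)

∈-boxed⁻ : ∀ {A} K → A ∈ boxed K → □ A ∈ K
∈-boxed⁻ (matom _ ∷ K) A∈ = there (∈-boxed⁻ K A∈)
∈-boxed⁻ (mbot ∷ K) A∈ = there (∈-boxed⁻ K A∈)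
∈-boxed⁻ ((_ ⊃ₘ _) ∷ K) A∈ = there (∈-boxed⁻ K A∈)
∈-boxed⁻ (□ _ ∷ K) (here refl) = here refl
∈-boxed⁻ (□ _ ∷ K) (there A∈) = there (∈-boxed⁻ K A∈)

indexOf : List MFm → MFm → ℕ
indexOf [] A = 0
indexOf (B ∷ K) A with A ≟ₘ B
... | yes _ = 0
... | no _ = suc (indexOf K A)

-- Out of range, nth returns the junk value mbot.
nth : List MFm → ℕ → MFm
nth [] _ = mbot
nth (A ∷ K) zero = A
nth (A ∷ K) (suc i) = nth K i

nth-indexOf : ∀ {A} K → A ∈ K → nth K (indexOf K A) ≡ A
nth-indexOf {A} (B ∷ K) A∈ with A ≟ₘ B | A∈
... | yes A≡B | _ = sym A≡B
... | no A≢B | here A≡B = ⊥-elim (A≢B A≡B)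
... | no _ | there A∈K = nth-indexOf K A∈K

realize : PTerm → MFm → Fm
realize t (matom P) = atom P
realize t mbot = bot
realize t (A ⊃ₘ B) = realize t A ⇒ realize t B
realize t (□ A) = [ e t ] realize t A

realize-FmJ : ∀ t A → InFmJ (realize t A)
realize-FmJ t (matom _) = tt
realize-FmJ t mbot = tt
realize-FmJ t (A ⊃ₘ B) = realize-FmJ t A , realize-FmJ t B
realize-FmJ t (□ A) = realize-FmJ t A

forget-realize : ∀ t A → forget (realize t A) (realize-FmJ t A) ≡ A
forget-realize t (matom _) = refl
forget-realize t mbot = refl
forget-realize t (A ⊃ₘ B) = cong₂ _⊃ₘ_ (forget-realize t A) (forget-realize t B)
forget-realize t (□ A) = cong □_ (forget-realize t A)

realizationBy : (MFm → PTerm) → Realization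
realizationBy Ω = record
  { r = λ A → realize (Ω A) A
  ; r-FmJ = λ A → realize-FmJ (Ω A) A
  ; r-forg = λ A → forget-realize (Ω A) A
  }

-- Propositional skeletons; the list L numbers the variables standing for atoms and boxes

module Skeleton (L : List MFm) where

  sk : MFm → PFm
  sk (matom P) = pvar (indexOf L (matom P))
  sk mbot = pbot
  sk (A ⊃ₘ B) = sk A ⇛ sk B
  sk (□ A) = pvar (indexOf L (□ A))

  lemmaSkeleton : MFm × MFm → PFm
  lemmaSkeleton (P , Q) = sk (□ P) ⇛ sk (□ Q)

  chain : List (MFm × MFm) → PFm → PFm
  chain xs ψ = foldr (λ x → lemmaSkeleton x ⇛_) ψ xs

  boxPairs : List MFm → List (MFm × MFm)
  boxPairs K = cartesianProduct (boxed K) (boxed K)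

  -- lemmas n K: the pairs (P , Q) with □ P, □ Q ∈ K such that P → Q and Q → P follow
  -- propositionally from lemmas of lower level, so that (RE) yields □ P → □ Q.
  mutual
    entailment : ℕ → MFm → MFm → PFm
    entailment m P Q = chain (lemmas m (subformulas P ++ subformulas Q)) (sk P ⇛ sk Q)

    Entails : ℕ → MFm → MFm → Set
    Entails m P Q = Tautology (entailment m P Q)

    Equivalent : ℕ → MFm × MFm → Set
    Equivalent m (P , Q) = Entails m P Q × Entails m Q P

    lemmas : ℕ → List MFm → List (MFm × MFm)
    lemmas zero K = []
    lemmas (suc m) K = filter (equivalent? m) (boxPairs K)

    equivalent? : ∀ m x → Dec (Equivalent m x)
    equivalent? m (P , Q) = taut? (entailment m P Q) ×-dec taut? (entailment m Q P)

  ∈-lemmas⁻ : ∀ {m K P Q} → (P , Q) ∈ lemmas (suc m) K → □ P ∈ K × □ Q ∈ K × Equivalent m (P , Q)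
  ∈-lemmas⁻ {m} {K} x∈ with ∈-filter⁻ (equivalent? m) x∈
  ... | x∈pairs , equivalent with ∈-cartesianProduct⁻ (boxed K) (boxed K) x∈pairs
  ... | P∈ , Q∈ = ∈-boxed⁻ K P∈ , ∈-boxed⁻ K Q∈ , equivalent

  ∈-lemmas⁺ : ∀ {m K P Q} → □ P ∈ K → □ Q ∈ K → Equivalent m (P , Q) → (P , Q) ∈ lemmas (suc m) K
  ∈-lemmas⁺ {m} {K} □P∈ □Q∈ =
    ∈-filter⁺ (equivalent? m) (∈-cartesianProduct⁺ (∈-boxed⁺ K □P∈) (∈-boxed⁺ K □Q∈))

  lemmas-mono : ∀ m {K K′} → K ⊆ K′ → lemmas m K ⊆ lemmas m K′
  lemmas-mono (suc m) {K′ = K′} K⊆K′ {P , Q} x∈ with ∈-lemmas⁻ {m} x∈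
  ... | □P∈ , □Q∈ , equivalent = ∈-lemmas⁺ {m} {K′} (K⊆K′ □P∈) (K⊆K′ □Q∈) equivalent

  lemmas-swap : ∀ m {K P Q} → (P , Q) ∈ lemmas m K → (Q , P) ∈ lemmas m K
  lemmas-swap (suc m) {K} x∈ with ∈-lemmas⁻ {m} {K} x∈
  ... | □P∈ , □Q∈ , (P⇒Q , Q⇒P) = ∈-lemmas⁺ {m} {K} □Q∈ □P∈ (Q⇒P , P⇒Q)

  LemmasHold : (ℕ → Bool) → List (MFm × MFm) → Set
  LemmasHold v = All (λ x → v ⊨ lemmaSkeleton x)

  ⊨-chain : ∀ {v ψ} xs → (LemmasHold v xs → v ⊨ ψ) → v ⊨ chain xs ψ
  ⊨-chain [] f = f []
  ⊨-chain {v} {ψ} (x ∷ xs) f = ⊨-⇛-intro {v} {lemmaSkeleton x} {chain xs ψ} (λ hx → ⊨-chain xs (f ∘ (hx ∷_)))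

  Within : ℕ → List MFm → MFm → Set
  Within n K A = subformulas A ⊆ K × size A < n

  within-⊃ˡ : ∀ {n K A B} → Within n K (A ⊃ₘ B) → Within n K A
  within-⊃ˡ {A = A} {B} (sub⊆ , size<) =
    sub⊆ ∘ subformulas-⊃ˡ , ≤-trans (s≤s (m≤m+n (size A) (size B))) (<⇒≤ size<)

  within-⊃ʳ : ∀ {n K A B} → Within n K (A ⊃ₘ B) → Within n K B
  within-⊃ʳ {A = A} {B} (sub⊆ , size<) =
    sub⊆ ∘ subformulas-⊃ʳ {A} , ≤-trans (s≤s (m≤n+m (size B) (size A))) (<⇒≤ size<)

  SequentValid : ℕ → List MFm → List MFm → List MFm → Set
  SequentValid n K Γ Δ = ∀ v → LemmasHold v (lemmas n K) → All (λ A → v ⊨ sk A) Γ → Any (λ A → v ⊨ sk A) Δ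

  -- The level n must exceed the size of every formula in the sequent, since each (RE) uses level n - 1.
  mutual
    sound : ∀ {n K Γ Δ} → GE Γ Δ → All (Within n K) Γ → All (Within n K) Δ → SequentValid n K Γ Δ
    sound (ax-P P) _ _ v _ (hP ∷ []) = here hP
    sound ax-⊥ _ _ v _ (() ∷ [])
    sound (perm Γ↭ Δ↭ d) wΓ wΔ v ℓ hΓ =
      Any-resp-↭ Δ↭ (sound d (All-resp-↭ (↭-sym Γ↭) wΓ) (All-resp-↭ (↭-sym Δ↭) wΔ) v ℓ
                             (All-resp-↭ (↭-sym Γ↭) hΓ))
    sound (⊃L {A = A} {B} d₁ d₂) (wAB ∷ wΓ) wΔ v ℓ (hAB ∷ hΓ)
      with sound d₁ wΓ (within-⊃ˡ wAB ∷ wΔ) v ℓ hΓ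
    ... | here hA = sound d₂ (within-⊃ʳ wAB ∷ wΓ) wΔ v ℓ (⊨-mp {v} {sk A} {sk B} hAB hA ∷ hΓ)
    ... | there hΔ = hΔ
    sound (⊃R {A = A} {B} d) wΓ (wAB ∷ wΔ) v ℓ hΓ =
      fromSum (⊨-⇛-or {v} {sk A} {sk B} λ hA →
        toSum (sound d (within-⊃ˡ wAB ∷ wΓ) (within-⊃ʳ wAB ∷ wΔ) v ℓ (hA ∷ hΓ)))
    sound (wL d) (_ ∷ wΓ) wΔ v ℓ (_ ∷ hΓ) = sound d wΓ wΔ v ℓ hΓ
    sound (wR d) wΓ (_ ∷ wΔ) v ℓ hΓ = there (sound d wΓ wΔ v ℓ hΓ)
    sound (cL d) (wA ∷ wΓ) wΔ v ℓ (hA ∷ hΓ) = sound d (wA ∷ wA ∷ wΓ) wΔ v ℓ (hA ∷ hA ∷ hΓ)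
    sound (cR d) wΓ (wA ∷ wΔ) v ℓ hΓ with sound d wΓ (wA ∷ wA ∷ wΔ) v ℓ hΓ
    ... | here hA = here hA
    ... | there hAΔ = hAΔ
    sound {zero} (RE _ _) ((_ , ()) ∷ []) _ _ _ _
    sound {suc m} {K} (RE {A} {B} d₁ d₂) ((sub□A , s≤s A<) ∷ []) ((sub□B , s≤s B<) ∷ []) v ℓ (h□A ∷ []) =
      here (⊨-mp {v} {sk (□ A)} {sk (□ B)} (All.lookup ℓ A,B∈lemmas) h□A)
      where
      A,B∈lemmas = ∈-lemmas⁺ {m} {K} (sub□A (here refl)) (sub□B (here refl))
                     (sound-entails d₁ A< B< , sound-entails d₂ B< A<)

    sound-entails : ∀ {m P Q} → GE (P ∷ []) (Q ∷ []) → size P < m → size Q < m → Entails m P Q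
    sound-entails {P = P} {Q} d P< Q< v = ⊨-chain _ λ ℓ → ⊨-⇛-intro {v} {sk P} {sk Q} λ hP →
      singleton⁻ (sound d ((∈-++⁺ˡ , P<) ∷ []) ((∈-++⁺ʳ (subformulas P) , Q<) ∷ []) v ℓ (hP ∷ []))

  theorem-tautology : ∀ {n K C} → GE [] (C ∷ []) → Within n K C → Tautology (chain (lemmas n K) (sk C))
  theorem-tautology d wC v = ⊨-chain _ λ ℓ → singleton⁻ (sound d [] (wC ∷ []) v ℓ [])

-- Internalised reasoning in JE_CS

module Internalisation (CS : ConstSpec) (appropriate : AxiomaticallyAppropriate CS) (schematic : Schematic CS) where

  open SchematicConstants CS appropriate schematic

  infix 3 ⊢_

  ⊢_ : Fm → Set
  ⊢_ = JE⊢ CS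

  ⊢-· : ∀ {s t A B} → ⊢ s ∶ (A ⇒ B) → ⊢ t ∶ A → ⊢ (s · t) ∶ B
  ⊢-· ⊢s ⊢t = mp (mp (ax (sj , i-j _ _ _ _)) ⊢s) ⊢t

  ⊢-! : ∀ {t A} → ⊢ t ∶ A → ⊢ (! t) ∶ (t ∶ A)
  ⊢-! = mp (ax (sj4 , i-j4 _ _))

  ⊢-reflect : ∀ {t A} → ⊢ t ∶ A → ⊢ A
  ⊢-reflect = mp (ax (sjt , i-jt _ _))

  -- For a non-tautology the term is the junk value pv 0; it is never used.
  tautTerm : (φ : PFm) → Dec (Tautology φ) → PTerm
  tautTerm φ (yes τ) = pc (tautConstant φ τ)
  tautTerm φ (no _) = pv 0

  ⊢-tautTerm : ∀ {φ} (φ? : Dec (Tautology φ)) → Tautology φ → ∀ σ → ⊢ tautTerm φ φ? ∶ substP σ φ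
  ⊢-tautTerm (yes τ) _ σ = an (tautConstant-spec _ τ σ)
  ⊢-tautTerm (no ¬τ) τ _ = ⊥-elim (¬τ τ)

  two : Fm → Fm → ℕ → Fm
  two A B 0 = A
  two A B 1 = B
  two A B _ = bot

  ∨-introˡ-schema ∨-introʳ-schema ∧-intro-schema : PFm
  ∨-introˡ-schema = pvar 0 ⇛ ((pvar 0 ⇛ pbot) ⇛ pvar 1)
  ∨-introʳ-schema = pvar 1 ⇛ ((pvar 0 ⇛ pbot) ⇛ pvar 1)
  ∧-intro-schema = pvar 0 ⇛ (pvar 1 ⇛ ((pvar 0 ⇛ (pvar 1 ⇛ pbot)) ⇛ pbot))

  ∨-introˡ-tautology : Tautology ∨-introˡ-schema
  ∨-introˡ-tautology v with v 0 | v 1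
  ... | true | true = refl
  ... | true | false = refl
  ... | false | _ = refl

  ∨-introʳ-tautology : Tautology ∨-introʳ-schema
  ∨-introʳ-tautology v with v 0 | v 1
  ... | true | true = refl
  ... | true | false = refl
  ... | false | true = refl
  ... | false | false = refl

  ∧-intro-tautology : Tautology ∧-intro-schema
  ∧-intro-tautology v with v 0 | v 1
  ... | true | true = refl
  ... | true | false = refl
  ... | false | _ = refl

  inlTerm inrTerm : PTerm → PTerm
  inlTerm t = pc (tautConstant ∨-introˡ-schema ∨-introˡ-tautology) · t
  inrTerm t = pc (tautConstant ∨-introʳ-schema ∨-introʳ-tautology) · t

  pairTerm : PTerm → PTerm → PTerm
  pairTerm t u = pc (tautConstant ∧-intro-schema ∧-intro-tautology) · t · u

  ⊢-inl : ∀ {t A B} → ⊢ t ∶ A → ⊢ inlTerm t ∶ (A ∨ᶠ B)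
  ⊢-inl {A = A} {B} = ⊢-· (an (tautConstant-spec _ ∨-introˡ-tautology (two A B)))

  ⊢-inr : ∀ {t A B} → ⊢ t ∶ B → ⊢ inrTerm t ∶ (A ∨ᶠ B)
  ⊢-inr {A = A} {B} = ⊢-· (an (tautConstant-spec _ ∨-introʳ-tautology (two A B)))

  ⊢-pair : ∀ {t u A B} → ⊢ t ∶ A → ⊢ u ∶ B → ⊢ pairTerm t u ∶ (A ∧ᶠ B)
  ⊢-pair {A = A} {B} ⊢t ⊢u = ⊢-· (⊢-· (an (tautConstant-spec _ ∧-intro-tautology (two A B))) ⊢t) ⊢u

  ⊢-sum : ∀ {t r s F} → ⊢ t ∶ ((r ∶ F) ∨ᶠ (s ∶ F)) → ⊢ (pc sumConstant · t) ∶ ((r ⊕ s) ∶ F)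
  ⊢-sum = ⊢-· (an (sumConstant-spec _ _ _))

  ⊢-je : ∀ {t s F G} → ⊢ t ∶ ((s ∶ (F ⇒ G)) ∧ᶠ (s ∶ (G ⇒ F)))
       → ⊢ (pc jeConstant · t) ∶ ([ e s ] F ⇒ [ e s ] G)
  ⊢-je = ⊢-· (an (jeConstant-spec _ _ _))

  ⨁ : {E : Set} → (E → PTerm) → List E → PTerm
  ⨁ term [] = pv 0
  ⨁ term (x ∷ xs) = term x ⊕ ⨁ term xs

  inject : {E : Set} → DecidableEquality E → E → List E → PTerm → PTerm
  inject _≟_ x [] t = t
  inject _≟_ x (y ∷ ys) t with x ≟ y
  ... | yes _ = pc sumConstant · inlTerm t
  ... | no _ = pc sumConstant · inrTerm (inject _≟_ x ys t)

  ⊢-inject : ∀ {E} (_≟_ : DecidableEquality E) (term : E → PTerm) {x ys t F}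
           → x ∈ ys → ⊢ t ∶ (term x ∶ F) → ⊢ inject _≟_ x ys t ∶ (⨁ term ys ∶ F)
  ⊢-inject _≟_ term {x} {y ∷ ys} x∈ ⊢t with x ≟ y | x∈
  ... | yes refl | _ = ⊢-sum (⊢-inl ⊢t)
  ... | no x≢y | here x≡y = ⊥-elim (x≢y x≡y)
  ... | no _ | there x∈ys = ⊢-sum (⊢-inr (⊢-inject _≟_ term x∈ys ⊢t))

  module UniformTerm (C : MFm) where

    L : List MFm
    L = subformulas C

    N : ℕ
    N = suc (size C)

    open Skeleton L

    _≟ᵉ_ : DecidableEquality (ℕ × MFm × MFm)
    _≟ᵉ_ = ≡-dec _≟ℕ_ (≡-dec _≟ₘ_ _≟ₘ_)

    levelEntries : ℕ → List (ℕ × MFm × MFm)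
    levelEntries m = map (m ,_) (lemmas m L)

    entries : List (ℕ × MFm × MFm)
    entries = concat (applyUpTo levelEntries (suc N))

    ∈-entries : ∀ {m P Q} → m ≤ N → (P , Q) ∈ lemmas m L → (m , P , Q) ∈ entries
    ∈-entries m≤N x∈ = ∈-concat⁺′ (∈-map⁺ (_ ,_) x∈) (∈-applyUpTo⁺ levelEntries (s≤s m≤N))

    mutual
      κ : ℕ → MFm → MFm → PTerm
      κ zero P Q = pv 0
      κ (suc m) P Q = foldl _·_ (tautTerm (entailment m P Q) (taut? (entailment m P Q)))
                                (map (ν m) (lemmas m (subformulas P ++ subformulas Q)))

      ν : ℕ → MFm × MFm → PTerm
      ν m (P , Q) = pc jeConstant · pairTerm (inject _≟ᵉ_ (m , P , Q) entries (! κ m P Q))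
                                             (inject _≟ᵉ_ (m , Q , P) entries (! κ m Q P))

    entryTerm : ℕ × MFm × MFm → PTerm
    entryTerm (m , P , Q) = κ m P Q

    Ω : PTerm
    Ω = ⨁ entryTerm entries

    rr : MFm → Fm
    rr = realize Ω

    σ : ℕ → Fm
    σ i = rr (nth L i)

    sk-realize : ∀ {A} → subformulas A ⊆ L → substP σ (sk A) ≡ rr A
    sk-realize {matom P} A⊆L = cong rr (nth-indexOf L (A⊆L (here refl)))
    sk-realize {mbot} _ = refl
    sk-realize {A ⊃ₘ B} A⊆L =
      cong₂ _⇒_ (sk-realize (A⊆L ∘ subformulas-⊃ˡ)) (sk-realize (A⊆L ∘ subformulas-⊃ʳ {A}))
    sk-realize {□ A} A⊆L = cong rr (nth-indexOf L (A⊆L (here refl)))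

    lemma-realize : ∀ {P Q} → □ P ∈ L → □ Q ∈ L
                  → substP σ (lemmaSkeleton (P , Q)) ≡ ([ e Ω ] rr P ⇒ [ e Ω ] rr Q)
    lemma-realize □P∈ □Q∈ =
      cong₂ _⇒_ (sk-realize (subformulas-trans C □P∈)) (sk-realize (subformulas-trans C □Q∈))

    subformulas-under-□ : ∀ {P} → □ P ∈ L → subformulas P ⊆ L
    subformulas-under-□ □P∈ = subformulas-trans C □P∈ ∘ subformulas-□

    ⊢-chain : ∀ {ψ} xs → ⊢ substP σ (chain xs ψ)
            → (∀ {x} → x ∈ xs → ⊢ substP σ (lemmaSkeleton x)) → ⊢ substP σ ψ
    ⊢-chain [] ⊢ψ _ = ⊢ψ
    ⊢-chain (x ∷ xs) ⊢x⇒ ⊢lemma = ⊢-chain xs (mp ⊢x⇒ (⊢lemma (here refl))) (⊢lemma ∘ there)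

    ⊢-·-chain : ∀ {t ψ} xs (f : MFm × MFm → PTerm) → ⊢ t ∶ substP σ (chain xs ψ)
              → (∀ {x} → x ∈ xs → ⊢ f x ∶ substP σ (lemmaSkeleton x))
              → ⊢ foldl _·_ t (map f xs) ∶ substP σ ψ
    ⊢-·-chain [] f ⊢t _ = ⊢t
    ⊢-·-chain (x ∷ xs) f ⊢t ⊢f = ⊢-·-chain xs f (⊢-· ⊢t (⊢f (here refl))) (⊢f ∘ there)

    mutual
      ⊢-κ : ∀ m {P Q} → Entails m P Q → subformulas P ⊆ L → subformulas Q ⊆ L → m < N
          → ⊢ κ (suc m) P Q ∶ (rr P ⇒ rr Q)
      ⊢-κ m {P} {Q} P⇒Q P⊆L Q⊆L m<N =
        subst (λ F → ⊢ κ (suc m) P Q ∶ F) (cong₂ _⇒_ (sk-realize P⊆L) (sk-realize Q⊆L))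
          (⊢-·-chain _ (ν m) (⊢-tautTerm (taut? (entailment m P Q)) P⇒Q σ)
            (⊢-ν m ([ P⊆L , Q⊆L ]′ ∘ ∈-++⁻ (subformulas P)) (<⇒≤ m<N)))

      ⊢-ν : ∀ m {K} → K ⊆ L → m ≤ N → ∀ {x} → x ∈ lemmas m K → ⊢ ν m x ∶ substP σ (lemmaSkeleton x)
      ⊢-ν (suc m) K⊆L m<N x∈ = ⊢-lemma (lemmas-mono (suc m) K⊆L x∈)
        where
        justify : ∀ {P Q} → (P , Q) ∈ lemmas (suc m) L
                → ⊢ inject _≟ᵉ_ (suc m , P , Q) entries (! κ (suc m) P Q) ∶ (Ω ∶ (rr P ⇒ rr Q))
        justify x∈ with ∈-lemmas⁻ {m} {L} x∈
        ... | □P∈ , □Q∈ , (P⇒Q , _) = ⊢-inject _≟ᵉ_ entryTerm (∈-entries m<N x∈)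
          (⊢-! (⊢-κ m P⇒Q (subformulas-under-□ □P∈) (subformulas-under-□ □Q∈) m<N))

        ⊢-lemma : ∀ {P Q} → (P , Q) ∈ lemmas (suc m) L
                → ⊢ ν (suc m) (P , Q) ∶ substP σ (lemmaSkeleton (P , Q))
        ⊢-lemma {P} {Q} x∈ with ∈-lemmas⁻ {m} {L} x∈
        ... | □P∈ , □Q∈ , _ =
          subst (λ F → ⊢ ν (suc m) (P , Q) ∶ F) (sym (lemma-realize □P∈ □Q∈))
            (⊢-je (⊢-pair (justify x∈) (justify (lemmas-swap (suc m) {L} x∈))))

    ⊢-realize : GE [] (C ∷ []) → ⊢ rr C
    ⊢-realize d = subst ⊢_ (sk-realize id)
      (⊢-chain {sk C} (lemmas N L) (ax (taut φ τ , i-taut φ τ σ)) (⊢-reflect ∘ ⊢-ν N id ≤-refl))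
      where
      φ = chain (lemmas N L) (sk C)
      τ : Tautology φ
      τ = theorem-tautology d (id , n<1+n (size C))

mainTheorem7 : (CS : ConstSpec) → IsConstSpec CS → AxiomaticallyAppropriate CS → Schematic CS
    → Σ Realization (λ ρ → ∀ (A : MFm) → GE [] (A ∷ []) → JE⊢ CS (Realization.r ρ A))
mainTheorem7 CS _ appropriate schematic = realizationBy UniformTerm.Ω , UniformTerm.⊢-realize
  where open Internalisation CS appropriate schematic
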